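{- Let $\Gamma$ be a cc0-language and let $D'$ with $0\in D'\subseteq\mathrm{dom}(\Gamma)$ be such that $D'\setminus\{0\}$ is a component of $\Gamma$. Then for every $d\in D'$: (1) the component generated by $d$ is the same in $\Gamma$ and in $\Gamma_{|D'}$; (2) the type of $d$ in $\Gamma_{|D'}$ is not greater than the type of $d$ in $\Gamma$.
   Context: $D$ is finite with distinguished $0$; $\Gamma$ is a finite set of relations on $D$, $\mathrm{dom}(\Gamma)$ the set of values in its tuples. $\Gamma$ is a cc0-language if all its relations contain the all-zero tuple and every relation containing the all-zero tuple obtained from a relation of $\Gamma$ by substituting constants for some coordinates belongs to $\Gamma$. $R_{|D'}=R\cap(D')^n$ and $\Gamma_{|D'}=\{R_{|D'}:R\in\Gamma\}$. An endomorphism of a language $\Delta$ is $h:\mathrm{dom}(\Delta)\to\mathrm{dom}(\Delta)$ with $h(0)=0$ mapping each tuple of each relation into that relation. For $X\subseteq D\setminus\{0\}$, $\mathrm{pr}_X$ fixes $X$ and sends everything else to $0$; a nonempty $C\subseteq D\setminus\{0\}$ is a component of $\Delta$ if $\mathrm{pr}_C$ is an endomorphism of $\Delta$; the component generated by $d$ is the inclusion-minimal component containing $d$. A multivalued morphism of $\Delta$ is $\phi:\mathrm{dom}(\Delta)\to2^{\mathrm{dom}(\Delta)}$ with $\phi(0)=\{0\}$ and $\phi(a_1)\times\dots\times\phi(a_r)\subseteq R$ for each $(a_1,..,a_r)\in R\in\Delta$. $x$ produces $y$ if some multivalued morphism has $\phi(x)=\{0,y\}$ and $\phi(z)=\{0\}$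 for $z\ne x$. Type of $y$: 1 (regular) if no multivalued morphism has $0,y\in\phi(x)$ for some $x$; 2 (semiregular) if such exists but no value produces $y$; 3 (self-producing) if $y$ produces $y$ and $y$ produces every value that produces $y$; 4 (degenerate) otherwise. -}

module Defs where

open import Data.Nat using (ℕ; zero; suc)
open import Data.Fin using (Fin) renaming (zero to fzero)
open import Data.Fin.Properties using (_≟_)
open import Data.Bool using (Bool; true; false; _∧_; not; if_then_else_)
open import Data.Maybe using (Maybe; just; nothing)
open import Data.Vec using (Vec; []; _∷_; map; replicate)
open import Data.List using (List)
import Data.List.Membership.Propositional as LM
import Data.Vec.Membership.Propositional as VM
open import Data.Product using (Σ; ∃; _×_; _,_)
open import Data.Sum using (_⊎_)
open import Relation.Nullary using (¬_)
open import Relation.Nullary.Decidable using (⌊_⌋)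
open import Relation.Binary.PropositionalEquality using (_≡_; _≢_; subst)

module _ (n : ℕ) where

  -- The finite domain D = {0, 1, ..., n}; the distinguished value 0 is fzero.
  D : Set
  D = Fin (suc n)

  record Rel : Set where
    constructor rel
    field
      arity : ℕ
      mem   : Vec D arity → Bool
  open Rel public

  Lang : Set
  Lang = List Rel

  _≐_ : Rel → Rel → Set
  R ≐ S = Σ (arity R ≡ arity S) λ p → ∀ u → mem R u ≡ mem S (subst (Vec D) p u)

  zeroTuple : (k : ℕ) → Vec D k
  zeroTuple k = replicate k fzero

  -- Substituting constants for some coordinates: σ i = just c substitutes c at
  -- coordinate i, σ i = nothing keeps the coordinate free.
  holes : ∀ {r} → Vec (Maybe D) r → ℕ
  holes [] = 0
  holes (nothing ∷ σ) = suc (holes σ)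
  holes (just _ ∷ σ) = holes σ

  fill : ∀ {r} (σ : Vec (Maybe D) r) → Vec D (holes σ) → Vec D r
  fill [] u = []
  fill (nothing ∷ σ) (x ∷ u) = x ∷ fill σ u
  fill (just c ∷ σ) u = c ∷ fill σ u

  substRel : (R : Rel) → Vec (Maybe D) (arity R) → Rel
  substRel R σ = rel (holes σ) (λ u → mem R (fill σ u))

  IsCC0 : Lang → Set
  IsCC0 Γ =
    (∀ R → R LM.∈ Γ → mem R (zeroTuple (arity R)) ≡ true)
    × (∀ R → R LM.∈ Γ → (σ : Vec (Maybe D) (arity R)) →
         mem (substRel R σ) (zeroTuple (arity (substRel R σ))) ≡ true →
         Σ Rel λ R' → R' LM.∈ Γ × (R' ≐ substRel R σ))

  Subset : Set
  Subset = D → Bool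

  allIn : Subset → ∀ {k} → Vec D k → Bool
  allIn S [] = true
  allIn S (x ∷ xs) = S x ∧ allIn S xs

  restrictRel : Subset → Rel → Rel
  restrictRel S R = rel (arity R) (λ t → mem R t ∧ allIn S t)

  restrict : Lang → Subset → Lang
  restrict Γ S = Data.List.map (restrictRel S) Γ

  InDom : Lang → D → Set
  InDom Δ x = Σ Rel λ R → R LM.∈ Δ × Σ (Vec D (arity R)) λ t → (mem R t ≡ true) × (x VM.∈ t)

  -- Endomorphisms (a function on D whose behaviour outside dom(Δ) is irrelevant)
  IsEndo : Lang → (D → D) → Set
  IsEndo Δ h =
    (h fzero ≡ fzero)
    × (∀ x → InDom Δ x → InDom Δ (h x))
    × (∀ R → R LM.∈ Δ → ∀ t → mem R t ≡ true → mem R (map h t) ≡ true)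

  pr : Subset → D → D
  pr X x = if X x then x else fzero

  IsComponent : Lang → Subset → Set
  IsComponent Δ C = (C fzero ≡ false) × (∃ λ x → C x ≡ true) × IsEndo Δ (pr C)

  _⊆_ : Subset → Subset → Set
  A ⊆ B = ∀ x → A x ≡ true → B x ≡ true

  IsGeneratedComponent : Lang → D → Subset → Set
  IsGeneratedComponent Δ d C =
    IsComponent Δ C × (C d ≡ true) × (∀ C' → IsComponent Δ C' → C' d ≡ true → C ⊆ C')

  -- Multivalued morphisms φ : dom(Δ) → 2^dom(Δ) (values outside dom(Δ) irrelevant)
  IsMVM : Lang → (D → Subset) → Set
  IsMVM Δ φ =
    (∀ y → φ fzero y ≡ true → y ≡ fzero) × (φ fzero fzero ≡ true)
    × (∀ x → InDom Δ x → ∀ y → φ x y ≡ true → InDom Δ y)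
    × (∀ R → R LM.∈ Δ → ∀ t → mem R t ≡ true →
         ∀ s → (∀ i → φ (Data.Vec.lookup t i) (Data.Vec.lookup s i) ≡ true) → mem R s ≡ true)

  Produces : Lang → D → D → Set
  Produces Δ x y = Σ (D → Subset) λ φ → IsMVM Δ φ × InDom Δ x
    × (∀ z → φ x z ≡ true → (z ≡ fzero ⊎ z ≡ y))
    × (φ x fzero ≡ true) × (φ x y ≡ true)
    × (∀ z → InDom Δ z → z ≢ x → ∀ w → φ z w ≡ true → w ≡ fzero)
    × (∀ z → InDom Δ z → z ≢ x → φ z fzero ≡ true)

  Type1 : Lang → D → Set
  Type1 Δ y = ¬ (Σ (D → Subset) λ φ → IsMVM Δ φ × Σ D λ x → InDom Δ x × (φ x fzero ≡ true) × (φ x y ≡ true))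

  Type2 : Lang → D → Set
  Type2 Δ y = ¬ Type1 Δ y × ¬ (Σ D λ x → Produces Δ x y)

  Type3 : Lang → D → Set
  Type3 Δ y = Produces Δ y y × (∀ x → Produces Δ x y → Produces Δ y x)

  data HasType (Δ : Lang) (y : D) : ℕ → Set where
    type1 : Type1 Δ y → HasType Δ y 1
    type2 : Type2 Δ y → HasType Δ y 2
    type3 : ¬ Type1 Δ y → ¬ Type2 Δ y → Type3 Δ y → HasType Δ y 3
    type4 : ¬ Type1 Δ y → ¬ Type2 Δ y → ¬ Type3 Δ y → HasType Δ y 4

  minus0 : Subset → Subset
  minus0 S x = S x ∧ not ⌊ x ≟ fzero ⌋

module Submission where

-- Everything rests on one observation: pr_T maps every tuple of a relation
-- R ∈ Γ to a tuple of R_{|D'}, and it fixes D' pointwise.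
--
-- (1) Call C a precomponent of Δ if 0 ∉ C and pr_C preserves Δ (a component
--     without the nonemptiness and domain side conditions). Precomponents are
--     closed under intersection (pr_{A∩B} = pr_A ∘ pr_B) and being one is
--     decidable, so the least precomponent containing d is a finite
--     intersection of explicitly chosen ones. Every precomponent of Γ is one
--     of Γ_{|D'}, and for a precomponent C of Γ_{|D'} the set C ∩ T is one of
--     Γ (via pr_{C∩T} = pr_C ∘ pr_T); hence the least precomponent of Γ
--     containing d is also least for Γ_{|D'}.
-- (2) Multivalued morphisms transfer both ways: φ ↦ φ(-) ∩ D' goes down and
--     φ ↦ φ(pr_T -) ∩ D' goes up; the same maps transfer "x produces y".
--     Three transfer facts (type 1, "no producer", type 3) then order the
--     types by a finite case analysis that works for any pair of languages.

open import Defs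
open import Data.Nat using (ℕ; _≤_; s≤s; z≤n; suc)
open import Data.Fin using (Fin) renaming (zero to fzero; suc to fsuc)
open import Data.Fin.Properties using (_≟_; all?)
open import Data.Fin.Subset.Properties using (anySubset?)
open import Data.Bool using (true; false; _∧_; if_then_else_)
open import Data.Bool.Properties using (∧-zeroʳ) renaming (_≟_ to _≟B_)
open import Data.Vec using (Vec; []; _∷_; map; lookup; tabulate)
open import Data.Vec.Properties using (lookup-map; map-∘; map-cong; lookup∘tabulate)
import Data.List.Membership.Propositional as LM
open import Data.List.Membership.Propositional.Properties using (∈-map⁺; ∈-map⁻)
import Data.Vec.Membership.Propositional as VM
open import Data.Vec.Relation.Unary.Any using (here; there)
open import Data.Vec.Membership.Propositional.Properties using () renaming (∈-map⁺ to VM-∈-map⁺)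
import Data.List.Relation.Unary.All as All
open import Data.Product using (Σ; _×_; _,_; proj₁; proj₂)
open import Data.Sum using (_⊎_; inj₁; inj₂)
open import Data.Empty using (⊥-elim)
open import Relation.Nullary using (¬_; Dec; yes; no)
open import Relation.Nullary.Decidable using (map′; _×-dec_; _→-dec_)
open import Relation.Unary using (Decidable)
open import Relation.Binary.PropositionalEquality
  using (_≡_; _≢_; refl; sym; trans; cong; subst)

∧-left : ∀ {a b} → a ∧ b ≡ true → a ≡ true
∧-left {true} _ = refl

∧-right : ∀ {a b} → a ∧ b ≡ true → b ≡ true
∧-right {true} p = p

∧-intro : ∀ {a b} → a ≡ true → b ≡ true → a ∧ b ≡ true
∧-intro refl refl = refl

true≢false : true ≢ false
true≢false ()

not-false : ∀ {b} → ¬ (b ≡ false) → b ≡ true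
not-false {true} _ = refl
not-false {false} b≢false = ⊥-elim (b≢false refl)

-- Universal statements over all tuples of a finite set are decidable; this is
-- what makes "pr_C preserves Δ" decidable.
allTuples? : ∀ {m} k {P : Vec (Fin m) k → Set} → Decidable P → Dec (∀ t → P t)
allTuples? 0 P? = map′ (λ p → λ { [] → p }) (λ f → f []) (P? [])
allTuples? (suc k) P? =
  map′ (λ f → λ { (x ∷ t) → f x t }) (λ f x t → f (x ∷ t))
       (all? λ x → allTuples? k (λ t → P? (x ∷ t)))

module _ {n : ℕ} where

  pr-in : ∀ (X : Subset n) {y} → X y ≡ true → pr n X y ≡ y
  pr-in X {y} p = cong (λ b → if b then y else fzero) p

  pr-out : ∀ (X : Subset n) {y} → X y ≡ false → pr n X y ≡ fzero
  pr-out X {y} p = cong (λ b → if b then y else fzero) p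

  pr-cases : ∀ (X : Subset n) y → (X y ≡ true × pr n X y ≡ y) ⊎ (X y ≡ false × pr n X y ≡ fzero)
  pr-cases X y with X y
  ... | true = inj₁ (refl , refl)
  ... | false = inj₂ (refl , refl)

  pr-zero : ∀ (X : Subset n) → pr n X fzero ≡ fzero
  pr-zero X with pr-cases X fzero
  ... | inj₁ (_ , e) = e
  ... | inj₂ (_ , e) = e

  -- pr_X only ever returns its argument or 0, so it preserves any property of 0.
  pr-preserves : ∀ (X : Subset n) (P : D n → Set) → P fzero → ∀ y → P y → P (pr n X y)
  pr-preserves X P P0 y Py with pr-cases X y
  ... | inj₁ (_ , e) = subst P (sym e) Py
  ... | inj₂ (_ , e) = subst P (sym e) P0

  _∩_ : Subset n → Subset n → Subset n
  (A ∩ B) y = A y ∧ B y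

  pr-∩ : ∀ (A B : Subset n) y → pr n (A ∩ B) y ≡ pr n A (pr n B y)
  pr-∩ A B y with pr-cases A y | pr-cases B y
  ... | inj₁ (Ay , eA) | inj₁ (By , eB) =
    trans (pr-in (A ∩ B) (∧-intro Ay By)) (sym (trans (cong (pr n A) eB) eA))
  ... | inj₂ (Ay , eA) | inj₁ (By , eB) =
    trans (pr-out (A ∩ B) (cong (_∧ B y) Ay)) (sym (trans (cong (pr n A) eB) eA))
  ... | _ | inj₂ (By , eB) =
    trans (pr-out (A ∩ B) (trans (cong (A y ∧_) By) (∧-zeroʳ (A y))))
          (sym (trans (cong (pr n A) eB) (pr-zero A)))

  map-pr-∩ : ∀ (A B : Subset n) {k} (t : Vec (D n) k) →
    map (pr n (A ∩ B)) t ≡ map (pr n A) (map (pr n B) t)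
  map-pr-∩ A B t = trans (map-cong (pr-∩ A B) t) (map-∘ (pr n A) (pr n B) t)

  allIn-map : ∀ (S : Subset n) (h : D n → D n) → (∀ y → S y ≡ true → S (h y) ≡ true) →
    ∀ {k} (t : Vec (D n) k) → allIn n S t ≡ true → allIn n S (map h t) ≡ true
  allIn-map S h hS [] _ = refl
  allIn-map S h hS (x ∷ t) p = ∧-intro (hS x (∧-left p)) (allIn-map S h hS t (∧-right p))

  allIn-map-into : ∀ (S : Subset n) (h : D n → D n) → (∀ y → S (h y) ≡ true) →
    ∀ {k} (t : Vec (D n) k) → allIn n S (map h t) ≡ true
  allIn-map-into S h hS [] = refl
  allIn-map-into S h hS (x ∷ t) = ∧-intro (hS x) (allIn-map-into S h hS t)

  allIn-lookup : ∀ (S : Subset n) {k} (s : Vec (D n) k) →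
    (∀ i → S (lookup s i) ≡ true) → allIn n S s ≡ true
  allIn-lookup S [] _ = refl
  allIn-lookup S (x ∷ s) f = ∧-intro (f fzero) (allIn-lookup S s (λ i → f (fsuc i)))

  allIn-∈ : ∀ (S : Subset n) {k} (t : Vec (D n) k) {x} → x VM.∈ t → allIn n S t ≡ true → S x ≡ true
  allIn-∈ S (y ∷ t) (here refl) p = ∧-left p
  allIn-∈ S (y ∷ t) (there x∈t) p = allIn-∈ S t x∈t (∧-right {S y} p)

  Preserves : Lang n → (D n → D n) → Set
  Preserves Δ h = ∀ R → R LM.∈ Δ → ∀ t → mem R t ≡ true → mem R (map h t) ≡ true

  -- A component without the side conditions "nonempty" and "pr_C maps dom(Δ) to dom(Δ)".
  IsPreComponent : Lang n → Subset n → Set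
  IsPreComponent Δ C = (C fzero ≡ false) × Preserves Δ (pr n C)

  component→precomponent : ∀ {Δ C} → IsComponent n Δ C → IsPreComponent Δ C
  component→precomponent (C0 , _ , _ , _ , preserves) = C0 , preserves

  precomponent→component : ∀ {Δ C d} → InDom n Δ fzero → IsPreComponent Δ C → C d ≡ true →
    IsComponent n Δ C
  precomponent→component {Δ} {C} {d} dom0 (C0 , preserves) Cd =
    C0 , (d , Cd) , pr-zero C , pr-dom , preserves
    where
    pr-dom : ∀ x → InDom n Δ x → InDom n Δ (pr n C x)
    pr-dom x domx = pr-preserves C (λ y → InDom n Δ y) dom0 x domx

  -- Precomponents are closed under intersection, since pr_{A∩B} = pr_A ∘ pr_B.
  precomponent-∩ : ∀ {Δ A B} → IsPreComponent Δ A → IsPreComponent Δ B → IsPreComponent Δ (A ∩ B)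
  precomponent-∩ {Δ} {A} {B} (A0 , presA) (_ , presB) = cong (_∧ B fzero) A0 , pres
    where
    pres : Preserves Δ (pr n (A ∩ B))
    pres R R∈ t Rt = subst (λ u → mem R u ≡ true) (sym (map-pr-∩ A B t))
                           (presA R R∈ (map (pr n B) t) (presB R R∈ t Rt))

  precomponent-resp : ∀ {Δ A B} → (∀ y → A y ≡ B y) → IsPreComponent Δ A → IsPreComponent Δ B
  precomponent-resp {Δ} {A} {B} A≗B (A0 , presA) = trans (sym (A≗B fzero)) A0 , pres
    where
    pres : Preserves Δ (pr n B)
    pres R R∈ t Rt = subst (λ u → mem R u ≡ true)
                           (map-cong (λ y → cong (λ b → if b then y else fzero) (A≗B y)) t)
                           (presA R R∈ t Rt)

  precomponent? : ∀ Δ → Decidable (IsPreComponent Δ)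
  precomponent? Δ C = (C fzero ≟B false) ×-dec preserves?
    where
    preservesRel? : ∀ R → Dec (∀ t → mem R t ≡ true → mem R (map (pr n C) t) ≡ true)
    preservesRel? R = allTuples? (arity R) λ t → (mem R t ≟B true) →-dec (mem R (map (pr n C) t) ≟B true)
    preserves? : Dec (Preserves Δ (pr n C))
    preserves? = map′ (λ all R R∈ → All.lookup all R∈) (λ f → All.tabulate (λ {R} → f R))
                      (All.all? preservesRel? Δ)

  ⋂ : Subset n → ∀ k → (Fin k → Subset n) → Subset n
  ⋂ B 0 f = B
  ⋂ B (suc k) f = f fzero ∩ ⋂ B k (λ i → f (fsuc i))

  ⋂-precomponent : ∀ {Δ B} k {f : Fin k → Subset n} → IsPreComponent Δ B →
    (∀ i → IsPreComponent Δ (f i)) → IsPreComponent Δ (⋂ B k f)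
  ⋂-precomponent 0 PB Pf = PB
  ⋂-precomponent (suc k) PB Pf =
    precomponent-∩ (Pf fzero) (⋂-precomponent k PB (λ i → Pf (fsuc i)))

  ⋂-member : ∀ {B} k {f : Fin k → Subset n} {y} → B y ≡ true → (∀ i → f i y ≡ true) →
    ⋂ B k f y ≡ true
  ⋂-member 0 By fy = By
  ⋂-member (suc k) By fy = ∧-intro (fy fzero) (⋂-member k By (λ i → fy (fsuc i)))

  ⋂-⊆ : ∀ {B} k {f : Fin k → Subset n} i {y} → ⋂ B k f y ≡ true → f i y ≡ true
  ⋂-⊆ (suc k) fzero p = ∧-left p
  ⋂-⊆ (suc k) {f} (fsuc i) {y} p = ⋂-⊆ k i (∧-right {f fzero y} p)

  -- If some precomponent B contains d, there is a least precomponent containing d: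
  -- for every x pick a precomponent containing d that avoids x whenever one
  -- exists (B otherwise), and intersect these choices with B.
  module _ (Δ : Lang n) (d : D n) where

    Separates : D n → Subset n → Set
    Separates x C = IsPreComponent Δ C × C d ≡ true × C x ≡ false

    separator : ∀ {B} → IsPreComponent Δ B → B d ≡ true → ∀ x →
      Σ (Subset n) λ C → IsPreComponent Δ C × C d ≡ true × (∀ C' → Separates x C' → C x ≡ false)
    separator {B} PB Bd x
      with anySubset? (λ v → precomponent? Δ (lookup v) ×-dec (lookup v d ≟B true) ×-dec (lookup v x ≟B false))
    ... | yes (v , Pv , vd , vx) = lookup v , Pv , vd , λ _ _ → vx
    ... | no none = B , PB , Bd , λ C' (PC' , C'd , C'x) → ⊥-elim (none (tabulate C' ,
          precomponent-resp (λ y → sym (lookup∘tabulate C' y)) PC' ,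
          trans (lookup∘tabulate C' d) C'd , trans (lookup∘tabulate C' x) C'x))

    least-precomponent : ∀ {B} → IsPreComponent Δ B → B d ≡ true →
      Σ (Subset n) λ G → IsPreComponent Δ G × G d ≡ true ×
        (∀ C → IsPreComponent Δ C → C d ≡ true → _⊆_ n G C)
    least-precomponent {B} PB Bd =
      G , ⋂-precomponent (suc n) {chosen} PB chosen-pre , ⋂-member (suc n) {chosen} Bd chosen-d , least
      where
      chosen : D n → Subset n
      chosen x = proj₁ (separator PB Bd x)
      chosen-pre : ∀ x → IsPreComponent Δ (chosen x)
      chosen-pre x = proj₁ (proj₂ (separator PB Bd x))
      chosen-d : ∀ x → chosen x d ≡ true
      chosen-d x = proj₁ (proj₂ (proj₂ (separator PB Bd x)))
      chosen-avoids : ∀ x C → Separates x C → chosen x x ≡ false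
      chosen-avoids x = proj₂ (proj₂ (proj₂ (separator PB Bd x)))
      G : Subset n
      G = ⋂ B (suc n) chosen
      least : ∀ C → IsPreComponent Δ C → C d ≡ true → _⊆_ n G C
      least C PC Cd x Gx = not-false λ Cx →
        true≢false (trans (sym (⋂-⊆ (suc n) {chosen} x Gx)) (chosen-avoids x C (PC , Cd , Cx)))

    generated-component : ∀ {G} → InDom n Δ fzero → IsPreComponent Δ G → G d ≡ true →
      (∀ C → IsPreComponent Δ C → C d ≡ true → _⊆_ n G C) → IsGeneratedComponent n Δ d G
    generated-component dom0 PG Gd least =
      precomponent→component dom0 PG Gd , Gd ,
      λ C' compC' C'd → least C' (component→precomponent compC') C'd

MVMPreserves : ∀ {n} → Lang n → (D n → Subset n) → Set
MVMPreserves {n} Δ φ = ∀ R → R LM.∈ Δ → ∀ t → mem R t ≡ true →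
  ∀ s → (∀ i → φ (lookup t i) (lookup s i) ≡ true) → mem R s ≡ true

type-≥1 : ∀ {n Δ y k} → HasType n Δ y k → 1 ≤ k
type-≥1 (type1 _) = s≤s z≤n
type-≥1 (type2 _) = s≤s z≤n
type-≥1 (type3 _ _ _) = s≤s z≤n
type-≥1 (type4 _ _ _) = s≤s z≤n

type-≤4 : ∀ {n Δ y k} → HasType n Δ y k → k ≤ 4
type-≤4 (type1 _) = s≤s z≤n
type-≤4 (type2 _) = s≤s (s≤s z≤n)
type-≤4 (type3 _ _ _) = s≤s (s≤s (s≤s z≤n))
type-≤4 (type4 _ _ _) = s≤s (s≤s (s≤s (s≤s z≤n)))

type-≤ : ∀ {n} {Δ Δ' : Lang n} {y} →
  (Type1 n Δ y → Type1 n Δ' y) →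
  (¬ (Σ (D n) λ x → Produces n Δ x y) → ¬ (Σ (D n) λ x → Produces n Δ' x y)) →
  (Type3 n Δ y → Type3 n Δ' y) →
  ∀ {k k'} → HasType n Δ' y k → HasType n Δ y k' → k ≤ k'
type-≤ _ _ _ (type1 _) hasType = type-≥1 hasType
type-≤ _ _ _ hasType (type4 _ _ _) = type-≤4 hasType
type-≤ _ _ _ (type2 _) (type2 _) = s≤s (s≤s z≤n)
type-≤ _ _ _ (type2 _) (type3 _ _ _) = s≤s (s≤s z≤n)
type-≤ _ _ _ (type3 _ _ _) (type3 _ _ _) = s≤s (s≤s (s≤s z≤n))
type-≤ regular _ _ (type2 (¬regular , _)) (type1 reg) = ⊥-elim (¬regular (regular reg))
type-≤ regular _ _ (type3 ¬regular _ _) (type1 reg) = ⊥-elim (¬regular (regular reg))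
type-≤ regular _ _ (type4 ¬regular _ _) (type1 reg) = ⊥-elim (¬regular (regular reg))
type-≤ _ producerless _ (type3 ¬regular ¬semi _) (type2 (_ , none)) = ⊥-elim (¬semi (¬regular , producerless none))
type-≤ _ producerless _ (type4 ¬regular ¬semi _) (type2 (_ , none)) = ⊥-elim (¬semi (¬regular , producerless none))
type-≤ _ _ selfProducing (type4 _ _ ¬self) (type3 _ _ self) = ⊥-elim (¬self (selfProducing self))

module Restriction {n : ℕ} (Γ : Lang n) (D' : Subset n)
  (D'0 : D' fzero ≡ true) (D'⊆dom : ∀ x → D' x ≡ true → InDom n Γ x)
  (T-component : IsComponent n Γ (minus0 n D')) where

  T : Subset n
  T = minus0 n D'

  Γ↾D' : Lang n
  Γ↾D' = restrict n Γ D'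

  T-member : ∀ {z} → D' z ≡ true → z ≢ fzero → T z ≡ true
  T-member {z} Dz z≢0 with z ≟ fzero
  ... | yes z≡0 = ⊥-elim (z≢0 z≡0)
  ... | no _ rewrite Dz = refl

  pr-T-fixes : ∀ {z} → D' z ≡ true → pr n T z ≡ z
  pr-T-fixes {z} Dz with z ≟ fzero
  ... | yes refl = pr-zero T
  ... | no _ rewrite Dz = refl

  pr-T-cases : ∀ z → (D' z ≡ true × pr n T z ≡ z) ⊎ pr n T z ≡ fzero
  pr-T-cases z with pr-cases T z
  ... | inj₁ (Tz , e) = inj₁ (∧-left Tz , e)
  ... | inj₂ (_ , e) = inj₂ e

  pr-T-into-D' : ∀ z → D' (pr n T z) ≡ true
  pr-T-into-D' z with pr-T-cases z
  ... | inj₁ (Dz , e) = subst (λ u → D' u ≡ true) (sym e) Dz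
  ... | inj₂ e = subst (λ u → D' u ≡ true) (sym e) D'0

  restrict-tuple : ∀ {R} → R LM.∈ Γ → ∀ {t} → mem R t ≡ true →
    mem (restrictRel n D' R) (map (pr n T) t) ≡ true
  restrict-tuple R∈ {t} Rt =
    ∧-intro (proj₂ (proj₂ (proj₂ (proj₂ T-component))) _ R∈ t Rt) (allIn-map-into D' (pr n T) pr-T-into-D' t)

  dom-restrict : ∀ {x} → D' x ≡ true → InDom n Γ↾D' x
  dom-restrict {x} Dx with D'⊆dom x Dx
  ... | R , R∈ , t , Rt , x∈t =
    restrictRel n D' R , ∈-map⁺ (restrictRel n D') R∈ , map (pr n T) t , restrict-tuple R∈ Rt ,
    subst (λ u → u VM.∈ map (pr n T) t) (pr-T-fixes Dx) (VM-∈-map⁺ (pr n T) x∈t)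

  dom-restrict⁻ : ∀ {x} → InDom n Γ↾D' x → D' x ≡ true
  dom-restrict⁻ (R' , R'∈ , t , R't , x∈t) with ∈-map⁻ (restrictRel n D') R'∈
  ... | R , _ , refl = allIn-∈ D' t x∈t (∧-right {mem R t} R't)

  -- Precomponents of Γ are precomponents of Γ_{|D'}: pr_C keeps D'-tuples inside D' as 0 ∈ D'.
  precomponent-restrict : ∀ {C} → IsPreComponent Γ C → IsPreComponent Γ↾D' C
  precomponent-restrict {C} (C0 , presC) = C0 , pres
    where
    pres : Preserves Γ↾D' (pr n C)
    pres R' R'∈ t R't with ∈-map⁻ (restrictRel n D') R'∈
    ... | R , R∈ , refl =
      ∧-intro (presC R R∈ t (∧-left R't))
              (allIn-map D' (pr n C) (pr-preserves C (λ z → D' z ≡ true) D'0) t (∧-right {mem R t} R't))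

  -- Conversely C ∩ T is a precomponent of Γ, since pr_{C∩T} = pr_C ∘ pr_T.
  precomponent-unrestrict : ∀ {C} → IsPreComponent Γ↾D' C → IsPreComponent Γ (C ∩ T)
  precomponent-unrestrict {C} (C0 , presC) = cong (_∧ T fzero) C0 , pres
    where
    pres : Preserves Γ (pr n (C ∩ T))
    pres R R∈ t Rt = subst (λ u → mem R u ≡ true) (sym (map-pr-∩ C T t))
      (∧-left (presC (restrictRel n D' R) (∈-map⁺ (restrictRel n D') R∈) (map (pr n T) t) (restrict-tuple R∈ Rt)))

  -- Part (1): the least precomponent of Γ containing d is least for Γ_{|D'} as well.
  same-generated-component : ∀ {d} → D' d ≡ true → d ≢ fzero →
    Σ (Subset n) λ G → IsGeneratedComponent n Γ d G × IsGeneratedComponent n Γ↾D' d G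
  same-generated-component {d} Dd d≢0
    with least-precomponent Γ d (component→precomponent T-component) (T-member Dd d≢0)
  ... | G , PG , Gd , leastΓ =
    G , generated-component Γ d (D'⊆dom fzero D'0) PG Gd leastΓ ,
        generated-component Γ↾D' d (dom-restrict D'0) (precomponent-restrict PG) Gd leastΓ↾D'
    where
    leastΓ↾D' : ∀ C → IsPreComponent Γ↾D' C → C d ≡ true → _⊆_ n G C
    leastΓ↾D' C PC Cd x Gx =
      ∧-left (leastΓ (C ∩ T) (precomponent-unrestrict PC) (∧-intro Cd (T-member Dd d≢0)) x Gx)

  restrictMVM : (D n → Subset n) → D n → Subset n
  restrictMVM φ x y = φ x y ∧ D' y

  mvm-restrict : ∀ {φ} → IsMVM n Γ φ → IsMVM n Γ↾D' (restrictMVM φ)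
  mvm-restrict {φ} (zero-only , zero-zero , _ , preserves) =
    (λ y p → zero-only y (∧-left p)) , ∧-intro zero-zero D'0 ,
    (λ x _ y p → dom-restrict (∧-right {φ x y} p)) , preserves↾
    where
    preserves↾ : MVMPreserves Γ↾D' (restrictMVM φ)
    preserves↾ R' R'∈ t R't s ts with ∈-map⁻ (restrictRel n D') R'∈
    ... | R , R∈ , refl =
      ∧-intro (preserves R R∈ t (∧-left R't) s (λ i → ∧-left (ts i)))
              (allIn-lookup D' s (λ i → ∧-right {φ (lookup t i) (lookup s i)} (ts i)))

  extendMVM : (D n → Subset n) → D n → Subset n
  extendMVM φ x y = φ (pr n T x) y ∧ D' y

  extend-in : ∀ φ {z w} → D' z ≡ true → φ z w ≡ true → D' w ≡ true → extendMVM φ z w ≡ true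
  extend-in φ {w = w} Dz zw Dw = ∧-intro (subst (λ u → φ u w ≡ true) (sym (pr-T-fixes Dz)) zw) Dw

  extend-in⁻ : ∀ φ {z w} → D' z ≡ true → extendMVM φ z w ≡ true → φ z w ≡ true
  extend-in⁻ φ {w = w} Dz p = subst (λ u → φ u w ≡ true) (pr-T-fixes Dz) (∧-left p)

  extend-cases : ∀ φ {z w} → extendMVM φ z w ≡ true → (D' z ≡ true × φ z w ≡ true) ⊎ φ fzero w ≡ true
  extend-cases φ {z} {w} p with pr-T-cases z
  ... | inj₁ (Dz , e) = inj₁ (Dz , subst (λ u → φ u w ≡ true) e (∧-left p))
  ... | inj₂ e = inj₂ (subst (λ u → φ u w ≡ true) e (∧-left p))

  extend-by-cases : ∀ φ {z w} → (D' z ≡ true → φ z w ≡ true) → φ fzero w ≡ true → D' w ≡ true →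
    extendMVM φ z w ≡ true
  extend-by-cases φ {z} {w} inD' at0 Dw with pr-T-cases z
  ... | inj₁ (Dz , e) = ∧-intro (subst (λ u → φ u w ≡ true) (sym e) (inD' Dz)) Dw
  ... | inj₂ e = ∧-intro (subst (λ u → φ u w ≡ true) (sym e) at0) Dw

  mvm-extend : ∀ {φ} → IsMVM n Γ↾D' φ → IsMVM n Γ (extendMVM φ)
  mvm-extend {φ} (zero-only , zero-zero , _ , preserves) =
    (λ y p → zero-only y (extend-in⁻ φ D'0 p)) , extend-in φ D'0 zero-zero D'0 ,
    (λ x _ y p → D'⊆dom y (∧-right {φ (pr n T x) y} p)) , preserves↑
    where
    preserves↑ : MVMPreserves Γ (extendMVM φ)
    preserves↑ R R∈ t Rt s ts =
      ∧-left (preserves (restrictRel n D' R) (∈-map⁺ (restrictRel n D') R∈) (map (pr n T) t)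
                        (restrict-tuple R∈ Rt) s
                        (λ i → subst (λ u → φ u (lookup s i) ≡ true) (sym (lookup-map i (pr n T) t)) (∧-left (ts i))))

  produces-restrict : ∀ {x y} → D' x ≡ true → D' y ≡ true → Produces n Γ x y → Produces n Γ↾D' x y
  produces-restrict Dx Dy (φ , mvm , _ , only0y , x0 , xy , others0 , others∋0) =
    restrictMVM φ , mvm-restrict mvm , dom-restrict Dx ,
    (λ z p → only0y z (∧-left p)) , ∧-intro x0 D'0 , ∧-intro xy Dy ,
    (λ z domz z≢x w p → others0 z (D'⊆dom z (dom-restrict⁻ domz)) z≢x w (∧-left p)) ,
    (λ z domz z≢x → ∧-intro (others∋0 z (D'⊆dom z (dom-restrict⁻ domz)) z≢x) D'0)

  produces-extend : ∀ {x y} → Produces n Γ↾D' x y → Produces n Γ x y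
  produces-extend {x} {y} (φ , mvm@(zero-only , zero-zero , values-in-dom , _) , domx , only0y , x0 , xy , others0 , others∋0) =
    extendMVM φ , mvm-extend mvm , D'⊆dom x Dx ,
    (λ z p → only0y z (extend-in⁻ φ Dx p)) , extend-in φ Dx x0 D'0 , extend-in φ Dx xy Dy ,
    others0↑ , others∋0↑
    where
    Dx : D' x ≡ true
    Dx = dom-restrict⁻ domx
    Dy : D' y ≡ true
    Dy = dom-restrict⁻ (values-in-dom x domx y xy)
    others0↑ : ∀ z → InDom n Γ z → z ≢ x → ∀ w → extendMVM φ z w ≡ true → w ≡ fzero
    others0↑ z _ z≢x w p with extend-cases φ p
    ... | inj₁ (Dz , zw) = others0 z (dom-restrict Dz) z≢x w zw
    ... | inj₂ 0w = zero-only w 0w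
    others∋0↑ : ∀ z → InDom n Γ z → z ≢ x → extendMVM φ z fzero ≡ true
    others∋0↑ z _ z≢x = extend-by-cases φ (λ Dz → others∋0 z (dom-restrict Dz) z≢x) zero-zero D'0

  type1-restrict : ∀ {y} → Type1 n Γ y → Type1 n Γ↾D' y
  type1-restrict {y} regular (φ , mvm@(_ , _ , values-in-dom , _) , x , domx , x0 , xy) =
    regular (extendMVM φ , mvm-extend mvm , x , D'⊆dom x Dx , extend-in φ Dx x0 D'0 , extend-in φ Dx xy Dy)
    where
    Dx : D' x ≡ true
    Dx = dom-restrict⁻ domx
    Dy : D' y ≡ true
    Dy = dom-restrict⁻ (values-in-dom x domx y xy)

  no-producer-restrict : ∀ {y} → ¬ (Σ (D n) λ x → Produces n Γ x y) → ¬ (Σ (D n) λ x → Produces n Γ↾D' x y)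
  no-producer-restrict none (x , p) = none (x , produces-extend p)

  type3-restrict : ∀ {y} → D' y ≡ true → Type3 n Γ y → Type3 n Γ↾D' y
  type3-restrict Dy (yy , producesBack) =
    produces-restrict Dy Dy yy ,
    λ x xy → produces-restrict Dy (producer-in-D' xy) (producesBack x (produces-extend xy))
    where
    producer-in-D' : ∀ {x y} → Produces n Γ↾D' x y → D' x ≡ true
    producer-in-D' (_ , _ , domx , _) = dom-restrict⁻ domx

-- Proposition 3.18.
proposition3p18 : (n : ℕ) (Γ : Lang n) (D' : Subset n) → IsCC0 n Γ →
    D' fzero ≡ true → (∀ x → D' x ≡ true → InDom n Γ x) →
    IsComponent n Γ (minus0 n D') →
    (d : D n) → D' d ≡ true → d ≢ fzero →
    (Σ (Subset n) λ C → IsGeneratedComponent n Γ d C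
        × IsGeneratedComponent n (restrict n Γ D') d C)
    × (∀ k k' → HasType n (restrict n Γ D') d k → HasType n Γ d k' → k ≤ k')
proposition3p18 n Γ D' _ D'0 D'⊆dom T-component d Dd d≢0 =
  same-generated-component Dd d≢0 ,
  λ _ _ → type-≤ type1-restrict no-producer-restrict (type3-restrict Dd)
  where open Restriction Γ D' D'0 D'⊆dom T-component
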